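{- For all positive integers $m$ and $n$, the disjoint union $2P_m\cup P_n$ (two copies of $P_m$ and one copy of $P_n$) is a $\langle 2,2\rangle$ CCE graph.
   Context: All graphs and digraphs are simple (no loops, no multiple arcs). $P_k$ denotes the path on $k$ vertices ($P_1$ is an isolated vertex). The CCE graph $CCE(D)$ of a digraph $D$ is the graph on $V(D)$ in which distinct $u,v$ are adjacent iff there exist vertices $x,y$ with $(y,u),(y,v),(u,x),(v,x)$ all arcs of $D$. A $\langle 2,2\rangle$ digraph is a digraph in which every vertex has indegree at most $2$ and outdegree at most $2$; a $\langle 2,2\rangle$ CCE graph is a graph isomorphic to the CCE graph of some $\langle 2,2\rangle$ digraph. -}

module Defs where

open import Data.Nat using (ℕ; _≤_)
import Data.Nat as ℕ
open import Data.Fin using (Fin; toℕ; zero; suc)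
open import Data.Bool using (Bool; true; false)
open import Data.Sum using (_⊎_; inj₁; inj₂)
open import Data.Product using (_×_; Σ; ∃₂)
open import Data.Empty using (⊥)
open import Relation.Nullary using (¬_)
open import Relation.Binary.PropositionalEquality using (_≡_)
open import Function.Bundles using (_↔_; Inverse)

record Digraph (k : ℕ) : Set where
  field
    arc      : Fin k → Fin k → Bool
    loopless : ∀ v → arc v v ≡ false
open Digraph public

count : ∀ {k} → (Fin k → Bool) → ℕ
count {ℕ.zero}  p = 0
count {ℕ.suc k} p with p zero
... | true  = ℕ.suc (count (λ i → p (suc i)))
... | false = count (λ i → p (suc i))

indeg : ∀ {k} → Digraph k → Fin k → ℕ
indeg D v = count (λ u → arc D u v)

outdeg : ∀ {k} → Digraph k → Fin k → ℕ
outdeg D v = count (λ w → arc D v w)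

Is22 : ∀ {k} → Digraph k → Set
Is22 D = ∀ v → (indeg D v ≤ 2) × (outdeg D v ≤ 2)

CCEAdj : ∀ {k} → Digraph k → Fin k → Fin k → Set
CCEAdj D u v = ¬ (u ≡ v) × ∃₂ λ x y →
  (arc D y u ≡ true) × (arc D y v ≡ true) × (arc D u x ≡ true) × (arc D v x ≡ true)

PathAdj : ∀ {k} → Fin k → Fin k → Set
PathAdj i j = (ℕ.suc (toℕ i) ≡ toℕ j) ⊎ (ℕ.suc (toℕ j) ≡ toℕ i)

V2PmPn : ℕ → ℕ → Set
V2PmPn m n = Fin m ⊎ (Fin m ⊎ Fin n)

Adj2PmPn : ∀ {m n} → V2PmPn m n → V2PmPn m n → Set
Adj2PmPn (inj₁ i)        (inj₁ j)        = PathAdj i j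
Adj2PmPn (inj₂ (inj₁ i)) (inj₂ (inj₁ j)) = PathAdj i j
Adj2PmPn (inj₂ (inj₂ i)) (inj₂ (inj₂ j)) = PathAdj i j
Adj2PmPn _               _               = ⊥

Is22CCE-2PmPn : ℕ → ℕ → Set
Is22CCE-2PmPn m n =
  ∃₂ λ (k : ℕ) (D : Digraph k) → Is22 D ×
    Σ (Fin k ↔ V2PmPn m n) λ e →
      ∀ u v → (CCEAdj D u v → Adj2PmPn (Inverse.to e u) (Inverse.to e v))
            × (Adj2PmPn (Inverse.to e u) (Inverse.to e v) → CCEAdj D u v)

-- Give every vertex v two codes s v, t v ∈ ℕ and draw an arc u → v whenever
-- s u ∈ {t v, t v + 1}.  If both codes are injective, every in- and
-- outdegree is at most 2, and if moreover s and t have the same image, two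
-- vertices are CCE-adjacent exactly when their s-codes are consecutive and
-- their t-codes are consecutive.  For 2P_m ∪ P_n, with N = n + m, the
-- s-codes list P_n, the first P_m, a gap at N, and the second P_m; the
-- t-codes list the second P_m, P_n, the gap at N, and the first P_m.  Along
-- each path both codes increase by one per step, and any two vertices in
-- different paths lie on opposite sides of the gap in s or in t.
module Submission where

open import Defs
open import Data.Nat using (ℕ; zero; suc; pred; _+_; _<_; _≤_; _≥_; z≤n; s≤s; _≟_)
open import Data.Nat.Properties
open import Data.Fin using (Fin; toℕ; fromℕ<; splitAt)
open import Data.Fin.Properties
  using (toℕ-injective; toℕ<n; toℕ-fromℕ<; toℕ-↑ˡ; toℕ-↑ʳ; splitAt⁻¹-↑ˡ; splitAt⁻¹-↑ʳ; +↔⊎)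
  renaming (suc-injective to fsuc-injective; 0≢1+n to fzero≢fsuc)
open import Data.Bool using (Bool; true; false)
open import Data.Sum using (_⊎_; inj₁; inj₂; swap) renaming (map to ⊎-map)
open import Data.Product using (_×_; _,_; ∃)
open import Data.Empty using (⊥-elim)
open import Function using (_∘_)
open import Function.Bundles using (_↔_; Inverse; Injection)
open import Function.Definitions using (Injective)
open import Function.Properties.Inverse using (↔-trans; ↔-refl; ↔⇒↣)
open import Data.Sum.Function.Propositional using (_⊎-↔_)
open import Relation.Nullary using (¬_; Dec; yes; does)
open import Relation.Nullary.Decidable using (_⊎-dec_; dec-true; dec-false)
open import Relation.Binary.PropositionalEquality

dec-true⁻¹ : ∀ {A : Set} (a? : Dec A) → does a? ≡ true → A
dec-true⁻¹ (yes a) _ = a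

Consecutive : ℕ → ℕ → Set
Consecutive a b = suc a ≡ b ⊎ suc b ≡ a

Covers : ℕ → ℕ → Set
Covers a b = a ≡ b ⊎ a ≡ suc b

covers? : ∀ a b → Dec (Covers a b)
covers? a b = (a ≟ b) ⊎-dec (a ≟ suc b)

module _ {a b : ℕ} where

  consecutive-sym : Consecutive a b → Consecutive b a
  consecutive-sym = swap

  consecutive⇒≢ : Consecutive a b → a ≢ b
  consecutive⇒≢ (inj₁ a+1≡b) refl = 1+n≢n a+1≡b
  consecutive⇒≢ (inj₂ b+1≡a) refl = 1+n≢n b+1≡a

  consecutive-+ : ∀ c → Consecutive a b → Consecutive (c + a) (c + b)
  consecutive-+ c = ⊎-map (trans (sym (+-suc c a)) ∘ cong (c +_))
                          (trans (sym (+-suc c b)) ∘ cong (c +_))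

  consecutive-suc : Consecutive a b → Consecutive (suc a) (suc b)
  consecutive-suc = ⊎-map (cong suc) (cong suc)

  +-cancelˡ-consecutive : ∀ c → Consecutive (c + a) (c + b) → Consecutive a b
  +-cancelˡ-consecutive c = ⊎-map (+-cancelˡ-≡ c _ _ ∘ trans (+-suc c a))
                                  (+-cancelˡ-≡ c _ _ ∘ trans (+-suc c b))

  common-lower⇒consecutive : ∀ {c} → Covers a c → Covers b c → a ≢ b → Consecutive a b
  common-lower⇒consecutive (inj₁ refl) (inj₁ refl) a≢b = ⊥-elim (a≢b refl)
  common-lower⇒consecutive (inj₁ refl) (inj₂ refl) a≢b = inj₁ refl
  common-lower⇒consecutive (inj₂ refl) (inj₁ refl) a≢b = inj₂ refl
  common-lower⇒consecutive (inj₂ refl) (inj₂ refl) a≢b = ⊥-elim (a≢b refl)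

  common-upper⇒consecutive : ∀ {c} → Covers c a → Covers c b → a ≢ b → Consecutive a b
  common-upper⇒consecutive (inj₁ refl) (inj₁ refl) a≢b = ⊥-elim (a≢b refl)
  common-upper⇒consecutive (inj₁ refl) (inj₂ b+1≡a) a≢b = inj₂ (sym b+1≡a)
  common-upper⇒consecutive (inj₂ a+1≡b) (inj₁ refl) a≢b = inj₁ (sym a+1≡b)
  common-upper⇒consecutive (inj₂ c≡a+1) (inj₂ c≡b+1) a≢b =
    ⊥-elim (a≢b (suc-injective (trans (sym c≡a+1) c≡b+1)))

  <⇒¬covers : a < b → ¬ Covers a b
  <⇒¬covers a<b (inj₁ refl) = <-irrefl refl a<b
  <⇒¬covers a<b (inj₂ refl) = <-asym a<b (n<1+n b)

  2+≤⇒¬covers : suc (suc b) ≤ a → ¬ Covers a b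
  2+≤⇒¬covers 2+b≤a (inj₁ refl) = <-irrefl refl (≤-trans (n≤1+n _) 2+b≤a)
  2+≤⇒¬covers 2+b≤a (inj₂ refl) = <-irrefl refl 2+b≤a

  ¬consecutive-across : ∀ {N} → a < N → ¬ Consecutive a (suc (N + b))
  ¬consecutive-across {N} a<N (inj₁ a+1≡N+b+1) = <⇒≢ (≤-trans a<N (m≤m+n N b)) (suc-injective a+1≡N+b+1)
  ¬consecutive-across {N} a<N (inj₂ refl) = <-asym a<N (s≤s (≤-trans (m≤m+n N b) (n≤1+n _)))

split-< : ∀ a {b p} → p < a + b → (∃ λ (i : Fin a) → toℕ i ≡ p) ⊎ (∃ λ (j : Fin b) → a + toℕ j ≡ p)
split-< a {b} {p} p<a+b with splitAt a (fromℕ< p<a+b) in eq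
... | inj₁ i = inj₁ (i , trans (sym (toℕ-↑ˡ i b)) (trans (cong toℕ (splitAt⁻¹-↑ˡ eq)) (toℕ-fromℕ< p<a+b)))
... | inj₂ j = inj₂ (j , trans (sym (toℕ-↑ʳ a j)) (trans (cong toℕ (splitAt⁻¹-↑ʳ eq)) (toℕ-fromℕ< p<a+b)))

count-none : ∀ {k} (p : Fin k → Bool) → (∀ i → p i ≢ true) → count p ≤ 0
count-none {zero} p none = z≤n
count-none {suc k} p none with p Fin.zero in p0
... | true = ⊥-elim (none Fin.zero p0)
... | false = count-none (p ∘ Fin.suc) (none ∘ Fin.suc)

count-≤1 : ∀ {k} (p : Fin k → Bool) → (∀ {i j} → p i ≡ true → p j ≡ true → i ≡ j) → count p ≤ 1
count-≤1 {zero} p unique = z≤n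
count-≤1 {suc k} p unique with p Fin.zero in p0
... | true = s≤s (count-none (p ∘ Fin.suc) (λ i pi → fzero≢fsuc (unique p0 pi)))
... | false = count-≤1 (p ∘ Fin.suc) (λ pi pj → fsuc-injective (unique pi pj))

count-tail-≤ : ∀ {k} (p : Fin (suc k) → Bool) → count (p ∘ Fin.suc) ≤ count p
count-tail-≤ p with p Fin.zero
... | true = n≤1+n _
... | false = ≤-refl

count-≤-+ : ∀ {k} (r p q : Fin k → Bool) → (∀ i → r i ≡ true → p i ≡ true ⊎ q i ≡ true) →
            count r ≤ count p + count q
count-≤-+ {zero} r p q r⊆p∪q = z≤n
count-≤-+ {suc k} r p q r⊆p∪q
  with r Fin.zero in r0 | count-≤-+ (r ∘ Fin.suc) (p ∘ Fin.suc) (q ∘ Fin.suc) (r⊆p∪q ∘ Fin.suc)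
... | false | ih = ≤-trans ih (+-mono-≤ (count-tail-≤ p) (count-tail-≤ q))
... | true  | ih with p Fin.zero in p0
...   | true = s≤s (≤-trans ih (+-monoʳ-≤ _ (count-tail-≤ q)))
...   | false with q Fin.zero | r⊆p∪q Fin.zero r0
...     | true  | _ = ≤-trans (s≤s ih) (≤-reflexive (sym (+-suc _ _)))
...     | false | inj₁ p0≡true with () ← trans (sym p0) p0≡true
...     | false | inj₂ ()

count-≤2 : ∀ {k} (p : Fin k → Bool) (f : Fin k → ℕ) {a b} → Injective _≡_ _≡_ f →
           (∀ i → p i ≡ true → f i ≡ a ⊎ f i ≡ b) → count p ≤ 2
count-≤2 {k} p f {a} {b} f-injective p⇒a∨b =
  ≤-trans (count-≤-+ p (hits a) (hits b) p⊆hits)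
          (+-mono-≤ (count-≤1 (hits a) unique) (count-≤1 (hits b) unique))
  where
  hits : ℕ → Fin k → Bool
  hits c i = does (f i ≟ c)

  unique : ∀ {c i j} → hits c i ≡ true → hits c j ≡ true → i ≡ j
  unique {c} {i} {j} hi hj = f-injective (trans (dec-true⁻¹ (f i ≟ c) hi) (sym (dec-true⁻¹ (f j ≟ c) hj)))

  p⊆hits : ∀ i → p i ≡ true → hits a i ≡ true ⊎ hits b i ≡ true
  p⊆hits i pi = ⊎-map (dec-true (f i ≟ a)) (dec-true (f i ≟ b)) (p⇒a∨b i pi)

module CodedDigraph {k : ℕ} {V : Set} (vertices : Fin k ↔ V) (s t : V → ℕ)
    (s-injective : Injective _≡_ _≡_ s) (t-injective : Injective _≡_ _≡_ t)
    (s⊆t : ∀ v → ∃ λ x → t x ≡ s v) (t⊆s : ∀ v → ∃ λ y → s y ≡ t v)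
    (¬self-covers : ∀ v → ¬ Covers (s v) (t v)) where

  open Inverse vertices using (to; from; strictlyInverseˡ)

  to-injective : Injective _≡_ _≡_ to
  to-injective = Injection.injective (↔⇒↣ vertices)

  digraph : Digraph k
  digraph = record
    { arc      = λ i j → does (covers? (s (to i)) (t (to j)))
    ; loopless = λ i → dec-false (covers? _ _) (¬self-covers (to i))
    }

  arc⇒covers : ∀ i j → arc digraph i j ≡ true → Covers (s (to i)) (t (to j))
  arc⇒covers i j = dec-true⁻¹ (covers? (s (to i)) (t (to j)))

  is22 : Is22 digraph
  is22 j = count-≤2 _ (s ∘ to) (to-injective ∘ s-injective) (λ i → arc⇒covers i j)
         , count-≤2 _ (t ∘ to) (to-injective ∘ t-injective)
             (λ l → ⊎-map sym (cong pred ∘ sym) ∘ arc⇒covers j l)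

  arc-to : ∀ {i x} → Covers (s (to i)) (t x) → arc digraph i (from x) ≡ true
  arc-to {i} {x} = dec-true (covers? _ _) ∘ subst (Covers (s (to i)) ∘ t) (sym (strictlyInverseˡ x))

  arc-from : ∀ {y j} → Covers (s y) (t (to j)) → arc digraph (from y) j ≡ true
  arc-from {y} {j} = dec-true (covers? _ _) ∘ subst (λ w → Covers (s w) (t (to j))) (sym (strictlyInverseˡ y))

  common-out-neighbour : ∀ {u v} → Consecutive (s u) (s v) →
                         ∃ λ x → Covers (s u) (t x) × Covers (s v) (t x)
  common-out-neighbour {u} (inj₁ su+1≡sv) with s⊆t u
  ... | x , tx≡su = x , inj₁ (sym tx≡su) , inj₂ (trans (sym su+1≡sv) (cong suc (sym tx≡su)))
  common-out-neighbour {v = v} (inj₂ sv+1≡su) with s⊆t v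
  ... | x , tx≡sv = x , inj₂ (trans (sym sv+1≡su) (cong suc (sym tx≡sv))) , inj₁ (sym tx≡sv)

  common-in-neighbour : ∀ {u v} → Consecutive (t u) (t v) →
                        ∃ λ y → Covers (s y) (t u) × Covers (s y) (t v)
  common-in-neighbour {v = v} (inj₁ tu+1≡tv) with t⊆s v
  ... | y , sy≡tv = y , inj₂ (trans sy≡tv (sym tu+1≡tv)) , inj₁ sy≡tv
  common-in-neighbour {u} (inj₂ tv+1≡tu) with t⊆s u
  ... | y , sy≡tu = y , inj₁ sy≡tu , inj₂ (trans sy≡tu (sym tv+1≡tu))

  CodesConsecutive : Fin k → Fin k → Set
  CodesConsecutive i j = Consecutive (s (to i)) (s (to j)) × Consecutive (t (to i)) (t (to j))

  cce⇒codes-consecutive : ∀ {i j} → CCEAdj digraph i j → CodesConsecutive i j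
  cce⇒codes-consecutive {i} {j} (i≢j , x , y , yi , yj , ix , jx) =
      common-lower⇒consecutive (arc⇒covers i x ix) (arc⇒covers j x jx) (i≢j ∘ to-injective ∘ s-injective)
    , common-upper⇒consecutive (arc⇒covers y i yi) (arc⇒covers y j yj) (i≢j ∘ to-injective ∘ t-injective)

  codes-consecutive⇒cce : ∀ {i j} → CodesConsecutive i j → CCEAdj digraph i j
  codes-consecutive⇒cce (si~sj , ti~tj) with common-out-neighbour si~sj | common-in-neighbour ti~tj
  ... | x , ix , jx | y , yi , yj =
    consecutive⇒≢ si~sj ∘ cong (s ∘ to) , from x , from y , arc-from yi , arc-from yj , arc-to ix , arc-to jx

module TwoPmPnCodes (m n : ℕ) (m≥1 : m ≥ 1) where

  N : ℕ
  N = n + m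

  s t : V2PmPn m n → ℕ
  s (inj₁ i)        = n + toℕ i
  s (inj₂ (inj₁ j)) = suc (N + toℕ j)
  s (inj₂ (inj₂ k)) = toℕ k
  t (inj₁ i)        = suc (N + toℕ i)
  t (inj₂ (inj₁ j)) = toℕ j
  t (inj₂ (inj₂ k)) = m + toℕ k

  n+i<N : (i : Fin m) → n + toℕ i < N
  n+i<N i = +-monoʳ-< n (toℕ<n i)

  k<N : (k : Fin n) → toℕ k < N
  k<N k = ≤-trans (toℕ<n k) (m≤m+n n m)

  j<N : (j : Fin m) → toℕ j < N
  j<N j = ≤-trans (toℕ<n j) (m≤n+m m n)

  m+k<N : (k : Fin n) → m + toℕ k < N
  m+k<N k = ≤-trans (+-monoʳ-< m (toℕ<n k)) (≤-reflexive (+-comm m n))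

  k<n+i : (k : Fin n) (i : Fin m) → toℕ k < n + toℕ i
  k<n+i k i = <-≤-trans (toℕ<n k) (m≤m+n n _)

  j<m+k : (j : Fin m) (k : Fin n) → toℕ j < m + toℕ k
  j<m+k j k = <-≤-trans (toℕ<n j) (m≤m+n m _)

  low<high : ∀ {a} b → a < N → a < suc (N + b)
  low<high b a<N = ≤-trans a<N (≤-trans (m≤m+n N b) (n≤1+n _))

  low≢high : ∀ {a} b → a < N → a ≢ suc (N + b)
  low≢high b = <⇒≢ ∘ low<high b

  s-injective : Injective _≡_ _≡_ s
  s-injective {inj₁ i}        {inj₁ i′}        eq = cong inj₁ (toℕ-injective (+-cancelˡ-≡ n _ _ eq))
  s-injective {inj₁ i}        {inj₂ (inj₁ j)}  eq = ⊥-elim (low≢high (toℕ j) (n+i<N i) eq)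
  s-injective {inj₁ i}        {inj₂ (inj₂ k)}  eq = ⊥-elim (<⇒≢ (k<n+i k i) (sym eq))
  s-injective {inj₂ (inj₁ j)} {inj₁ i}         eq = ⊥-elim (low≢high (toℕ j) (n+i<N i) (sym eq))
  s-injective {inj₂ (inj₁ j)} {inj₂ (inj₁ j′)} eq =
    cong (inj₂ ∘ inj₁) (toℕ-injective (+-cancelˡ-≡ N _ _ (suc-injective eq)))
  s-injective {inj₂ (inj₁ j)} {inj₂ (inj₂ k)}  eq = ⊥-elim (low≢high (toℕ j) (k<N k) (sym eq))
  s-injective {inj₂ (inj₂ k)} {inj₁ i}         eq = ⊥-elim (<⇒≢ (k<n+i k i) eq)
  s-injective {inj₂ (inj₂ k)} {inj₂ (inj₁ j)}  eq = ⊥-elim (low≢high (toℕ j) (k<N k) eq)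
  s-injective {inj₂ (inj₂ k)} {inj₂ (inj₂ k′)} eq = cong (inj₂ ∘ inj₂) (toℕ-injective eq)

  t-injective : Injective _≡_ _≡_ t
  t-injective {inj₁ i}        {inj₁ i′}        eq =
    cong inj₁ (toℕ-injective (+-cancelˡ-≡ N _ _ (suc-injective eq)))
  t-injective {inj₁ i}        {inj₂ (inj₁ j)}  eq = ⊥-elim (low≢high (toℕ i) (j<N j) (sym eq))
  t-injective {inj₁ i}        {inj₂ (inj₂ k)}  eq = ⊥-elim (low≢high (toℕ i) (m+k<N k) (sym eq))
  t-injective {inj₂ (inj₁ j)} {inj₁ i}         eq = ⊥-elim (low≢high (toℕ i) (j<N j) eq)
  t-injective {inj₂ (inj₁ j)} {inj₂ (inj₁ j′)} eq = cong (inj₂ ∘ inj₁) (toℕ-injective eq)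
  t-injective {inj₂ (inj₁ j)} {inj₂ (inj₂ k)}  eq = ⊥-elim (<⇒≢ (j<m+k j k) eq)
  t-injective {inj₂ (inj₂ k)} {inj₁ i}         eq = ⊥-elim (low≢high (toℕ i) (m+k<N k) eq)
  t-injective {inj₂ (inj₂ k)} {inj₂ (inj₁ j)}  eq = ⊥-elim (<⇒≢ (j<m+k j k) (sym eq))
  t-injective {inj₂ (inj₂ k)} {inj₂ (inj₂ k′)} eq = cong (inj₂ ∘ inj₂) (toℕ-injective (+-cancelˡ-≡ m _ _ eq))

  s-onto-low : ∀ {p} → p < N → ∃ λ y → s y ≡ p
  s-onto-low p<N with split-< n p<N
  ... | inj₁ (k , k≡p)   = inj₂ (inj₂ k) , k≡p
  ... | inj₂ (i , n+i≡p) = inj₁ i , n+i≡p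

  t-onto-low : ∀ {p} → p < N → ∃ λ x → t x ≡ p
  t-onto-low {p} p<N with split-< m (subst (p <_) (+-comm n m) p<N)
  ... | inj₁ (j , j≡p)   = inj₂ (inj₁ j) , j≡p
  ... | inj₂ (k , m+k≡p) = inj₂ (inj₂ k) , m+k≡p

  s⊆t : ∀ v → ∃ λ x → t x ≡ s v
  s⊆t (inj₁ i)        = t-onto-low (n+i<N i)
  s⊆t (inj₂ (inj₁ j)) = inj₁ j , refl
  s⊆t (inj₂ (inj₂ k)) = t-onto-low (k<N k)

  t⊆s : ∀ v → ∃ λ y → s y ≡ t v
  t⊆s (inj₁ i)        = inj₂ (inj₁ i) , refl
  t⊆s (inj₂ (inj₁ j)) = s-onto-low (j<N j)
  t⊆s (inj₂ (inj₂ k)) = s-onto-low (m+k<N k)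

  ¬self-covers : ∀ v → ¬ Covers (s v) (t v)
  ¬self-covers (inj₁ i)        = <⇒¬covers (low<high (toℕ i) (n+i<N i))
  ¬self-covers (inj₂ (inj₁ j)) = 2+≤⇒¬covers (s≤s (+-monoˡ-≤ (toℕ j) (≤-trans m≥1 (m≤n+m m n))))
  ¬self-covers (inj₂ (inj₂ k)) = <⇒¬covers (m<n+m (toℕ k) m≥1)

  adjacent⇒consecutive : ∀ u v → Adj2PmPn u v → Consecutive (s u) (s v) × Consecutive (t u) (t v)
  adjacent⇒consecutive (inj₁ i)        (inj₁ i′)        i~i′ =
    consecutive-+ n i~i′ , consecutive-suc (consecutive-+ N i~i′)
  adjacent⇒consecutive (inj₂ (inj₁ j)) (inj₂ (inj₁ j′)) j~j′ =
    consecutive-suc (consecutive-+ N j~j′) , j~j′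
  adjacent⇒consecutive (inj₂ (inj₂ k)) (inj₂ (inj₂ k′)) k~k′ = k~k′ , consecutive-+ m k~k′

  consecutive⇒adjacent : ∀ u v → Consecutive (s u) (s v) × Consecutive (t u) (t v) → Adj2PmPn u v
  consecutive⇒adjacent (inj₁ i)        (inj₁ i′)        (s~ , _) = +-cancelˡ-consecutive n s~
  consecutive⇒adjacent (inj₁ i)        (inj₂ (inj₁ j))  (s~ , _) = ¬consecutive-across (n+i<N i) s~
  consecutive⇒adjacent (inj₁ i)        (inj₂ (inj₂ k))  (_ , t~) = ¬consecutive-across (m+k<N k) (consecutive-sym t~)
  consecutive⇒adjacent (inj₂ (inj₁ j)) (inj₁ i)         (s~ , _) = ¬consecutive-across (n+i<N i) (consecutive-sym s~)
  consecutive⇒adjacent (inj₂ (inj₁ j)) (inj₂ (inj₁ j′)) (_ , t~) = t~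
  consecutive⇒adjacent (inj₂ (inj₁ j)) (inj₂ (inj₂ k))  (s~ , _) = ¬consecutive-across (k<N k) (consecutive-sym s~)
  consecutive⇒adjacent (inj₂ (inj₂ k)) (inj₁ i)         (_ , t~) = ¬consecutive-across (m+k<N k) t~
  consecutive⇒adjacent (inj₂ (inj₂ k)) (inj₂ (inj₁ j))  (s~ , _) = ¬consecutive-across (k<N k) s~
  consecutive⇒adjacent (inj₂ (inj₂ k)) (inj₂ (inj₂ k′)) (s~ , _) = s~

  vertices : Fin (m + (m + n)) ↔ V2PmPn m n
  vertices = ↔-trans +↔⊎ (↔-refl ⊎-↔ +↔⊎)

  open CodedDigraph vertices s t s-injective t-injective s⊆t t⊆s ¬self-covers public

proposition3p6 : (m n : ℕ) → m ≥ 1 → n ≥ 1 → Is22CCE-2PmPn m n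
proposition3p6 m n m≥1 _ =
  m + (m + n) , digraph , is22 , vertices , λ i j →
    consecutive⇒adjacent (to i) (to j) ∘ cce⇒codes-consecutive ,
    codes-consecutive⇒cce ∘ adjacent⇒consecutive (to i) (to j)
  where
  open TwoPmPnCodes m n m≥1
  open Inverse vertices using (to)
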